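{- Let $n,m\ge1$. Then (1) $SH^{\succ}(n,m)=\{\gamma\in\mathcal P_{n+m}:\gamma\le_B\xi_{n,m-1}\times1_1\}$; (2) $SH^{\bullet}(n,m)=\{\gamma\in\mathcal P_{n+m}: z(n-1,m-1,0)\le_B\gamma\le_B(\xi_{n-1,m-1}\times1_1)\circ z(n-1,m-1,0)\}$; (3) $SH^{\prec}(n,m)=\{\gamma\in\mathcal P_{n+m}: z(n-1,m)\le_B\gamma\le_B\xi_{n,m}\}$, where $z(n-1,m-1,0)=(1,\dots,n-1,n+m-1,n,\dots,n+m-1)$ and $z(n-1,m)=(1,\dots,n-1,n+m,n,\dots,n+m-1)$.
   Context: For $N\ge1$, $\mathcal P_N$ is the set of surjective maps $\gamma:\{1,\dots,N\}\to\{1,\dots,r\}$ ($r\ge1$), written $(\gamma(1),\dots,\gamma(N))$; composition is composition of maps; $1_1=(1)$. For $\gamma\in\mathcal P_{N,r}$ (image $\{1,\dots,r\}$), $\delta\in\mathcal P_{M,s}$: $\gamma\times\delta=(\gamma(1),\dots,\gamma(N),\delta(1)+r,\dots,\delta(M)+r)$, and $\gamma\times(0)=\gamma$ where $(0)$ is the unique element of $\mathcal P_0$. For $r\ge2$, $1\le i\le r-1$, $t_i\in\mathcal P_{r,r-1}$: $t_i(j)=j$ ($j\le i$), $j-1$ ($j>i$). $\gamma^{ -1}(i)<\gamma^{ -1}(i+1)$ means every element of $\gamma^{ -1}(i)$ is less than every element of $\gamma^{ -1}(i+1)$. The weak Bruhat order $\le_B$ on $\mathcal P_N$ is the reflexive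 transitive closure of: $\gamma<_B t_i\circ\gamma$ if $\gamma^{ -1}(i)<\gamma^{ -1}(i+1)$, and $t_i\circ\gamma<_B\gamma$ if $\gamma^{ -1}(i)>\gamma^{ -1}(i+1)$. $SH(n,m)$ is the set of $\gamma\in\mathcal P_{n+m}$ with $\gamma(1)<\dots<\gamma(n)$ and $\gamma(n+1)<\dots<\gamma(n+m)$; $SH^{\succ}(n,m)$, $SH^{\bullet}(n,m)$, $SH^{\prec}(n,m)$ are its subsets where $\gamma(n)<\gamma(n+m)$, $\gamma(n)=\gamma(n+m)$, $\gamma(n)>\gamma(n+m)$ respectively. For non-negative $a,b$, $\xi_{a,b}$ is the permutation of $\{1,\dots,a+b\}$ with $\xi_{a,b}(k)=k+b$ for $k\le a$ and $\xi_{a,b}(k)=k-a$ for $k>a$ ($\xi_{a,0}=\xi_{0,b}=$ identity). -}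

module Defs where

open import Data.Nat using (ℕ; zero; suc; _+_; _∸_; _≤_; _<_; _≤?_; _⊔_)
open import Data.Bool using (if_then_else_)
open import Data.List using (List; []; _∷_; _++_; map; length; applyUpTo; foldr; [_])
open import Data.Product using (Σ; ∃; _×_)
open import Relation.Nullary.Decidable using (⌊_⌋)
open import Relation.Binary.PropositionalEquality using (_≡_)
open import Relation.Binary.Construct.Closure.ReflexiveTransitive using (Star)

-- Elements of P_N are represented as lists (γ(1),…,γ(N)) of naturals.

-- 1-indexed lookup: at γ k = γ(k) for 1 ≤ k ≤ length γ (and 0 otherwise).
at : List ℕ → ℕ → ℕ
at []      _             = 0
at (x ∷ _) zero          = 0
at (x ∷ _) (suc zero)    = x
at (_ ∷ xs) (suc (suc k)) = at xs (suc k)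

IsP : ℕ → ℕ → List ℕ → Set
IsP N r γ =
  (length γ ≡ N) ×
  (∀ k → 1 ≤ k → k ≤ N → (1 ≤ at γ k) × (at γ k ≤ r)) ×
  (∀ j → 1 ≤ j → j ≤ r → ∃ λ k → (1 ≤ k) × (k ≤ N) × (at γ k ≡ j))

InP : ℕ → List ℕ → Set
InP N γ = Σ ℕ λ r → IsP N r γ

_∘P_ : List ℕ → List ℕ → List ℕ
γ ∘P δ = map (at γ) δ

rk : List ℕ → ℕ
rk = foldr _⊔_ 0

_×P_ : List ℕ → List ℕ → List ℕ
γ ×P δ = γ ++ map (rk γ +_) δ

one₁ : List ℕ
one₁ = [ 1 ]

t : ℕ → ℕ → ℕ
t i j = if ⌊ j ≤? i ⌋ then j else j ∸ 1

Before : ℕ → List ℕ → ℕ → ℕ → Set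
Before N γ a b = ∀ p q → 1 ≤ p → p ≤ N → 1 ≤ q → q ≤ N →
                 at γ p ≡ a → at γ q ≡ b → p < q

data BStep (N : ℕ) : List ℕ → List ℕ → Set where
  up   : ∀ {γ r i} → IsP N r γ → 1 ≤ i → i < r → Before N γ i (suc i) →
         BStep N γ (map (t i) γ)
  down : ∀ {γ r i} → IsP N r γ → 1 ≤ i → i < r → Before N γ (suc i) i →
         BStep N (map (t i) γ) γ

_≤B[_]_ : List ℕ → ℕ → List ℕ → Set
γ ≤B[ N ] δ = Star (BStep N) γ δ

SH : ℕ → ℕ → List ℕ → Set
SH n m γ = InP (n + m) γ ×
  (∀ i j → 1 ≤ i → i < j → j ≤ n → at γ i < at γ j) ×
  (∀ i j → n < i → i < j → j ≤ n + m → at γ i < at γ j)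

SH≻ SH• SH≺ : ℕ → ℕ → List ℕ → Set
SH≻ n m γ = SH n m γ × (at γ n < at γ (n + m))
SH• n m γ = SH n m γ × (at γ n ≡ at γ (n + m))
SH≺ n m γ = SH n m γ × (at γ (n + m) < at γ n)

ξ : ℕ → ℕ → List ℕ
ξ a b = applyUpTo (λ k → if ⌊ suc k ≤? a ⌋ then suc k + b else suc k ∸ a) (a + b)

z₀ : ℕ → ℕ → List ℕ
z₀ n m = applyUpTo suc (n ∸ 1) ++ [ n + m ∸ 1 ] ++ applyUpTo (n +_) m

z₁ : ℕ → ℕ → List ℕ
z₁ n m = applyUpTo suc (n ∸ 1) ++ [ n + m ] ++ applyUpTo (n +_) m

module Submission where

-- A shuffle γ ∈ SH(n,m) of rank r is encoded by a word of length r over {L, R, LR}: its v-th letter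
-- says whether the value v is taken in the left block γ(1..n) only, in the right block only, or in both.
-- Since each block is increasing, γ(n) and γ(n+m) are the block maxima, so the last letter, that of the
-- value r, decides whether γ(n) >, < or = γ(n+m).
-- On words the weak-order steps are the merge L R → LR (applying t_i) and the split LR → R L (undoing t_i).
-- Bubbling letters puts every word w z between the sorted words Lᵃ Rᵇ z and Rᵇ Lᵃ z, whose shuffles are
-- the bounds of the theorem. Conversely, going up in the weak order can turn an ascent γ(p) < γ(q), p < q,
-- into a tie and a tie into a descent, never the other way round. Hence whatever lies below the upper bound
-- keeps the ascents inside each block, so it is a shuffle, and its comparison of γ(n) with γ(n+m) is
-- inherited from the bounds.

open import Defs
open import Data.Nat using (ℕ; zero; suc; _+_; _∸_; _≤_; _<_; _≤?_; _<?_; _≟_; _⊔_; _⊓_; z≤n; s≤s; z<s)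
open import Data.Nat.Properties
open import Data.Bool using (Bool; true; false; if_then_else_)
open import Data.List
  using (List; []; _∷_; _++_; _∷ʳ_; [_]; map; length; applyUpTo; replicate; take; drop; initLast; _∷ʳ′_)
open import Data.List.Properties
  using (map-++; length-map; length-++; ++-assoc; ++-identityʳ; length-take; length-drop; take++drop≡id)
open import Data.List.Relation.Unary.All as All using (All; []; _∷_)
open import Data.List.Relation.Unary.All.Properties using (++⁺; ++⁻)
open import Data.List.Relation.Unary.AllPairs using (AllPairs; []; _∷_)
open import Data.List.Relation.Unary.Any using (here; there)
open import Data.List.Membership.Propositional using (_∈_; _∉_)
open import Data.List.Membership.Propositional.Properties using (∈-++⁺ˡ; ∈-++⁺ʳ; ∈-++⁻)
open import Data.List.Membership.DecPropositional _≟_ using (_∈?_)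
open import Data.Product using (Σ; ∃; _×_; _,_; proj₁; proj₂)
open import Data.Sum using (_⊎_; inj₁; inj₂)
open import Data.Empty using (⊥-elim)
open import Relation.Nullary using (¬_; Dec; yes; no)
open import Relation.Nullary.Decidable using (⌊_⌋)
open import Relation.Binary.PropositionalEquality hiding ([_])
open import Relation.Binary.Construct.Closure.ReflexiveTransitive using (Star; ε; _◅_; _◅◅_; gmap; fold)
open import Function.Bundles using (_⇔_; mk⇔; module Equivalence)

at-∈ : ∀ xs {k} → 1 ≤ k → k ≤ length xs → at xs k ∈ xs
at-∈ (x ∷ xs) {suc zero}    _ _        = here refl
at-∈ (x ∷ xs) {suc (suc k)} _ (s≤s k≤) = there (at-∈ xs z<s k≤)

∈⇒at : ∀ {x} xs → x ∈ xs → ∃ λ k → (1 ≤ k) × (k ≤ length xs) × (at xs k ≡ x)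
∈⇒at (y ∷ xs) (here refl) = 1 , z<s , z<s , refl
∈⇒at (y ∷ xs) (there x∈) with ∈⇒at xs x∈
... | suc k , _ , k≤ , eq = suc (suc k) , z<s , s≤s k≤ , eq

at-++ˡ : ∀ xs ys {k} → 1 ≤ k → k ≤ length xs → at (xs ++ ys) k ≡ at xs k
at-++ˡ (x ∷ xs) ys {suc zero}    _ _        = refl
at-++ˡ (x ∷ xs) ys {suc (suc k)} _ (s≤s k≤) = at-++ˡ xs ys z<s k≤

at-++ʳ : ∀ xs ys {k} → 1 ≤ k → at (xs ++ ys) (length xs + k) ≡ at ys k
at-++ʳ []           ys         _ = refl
at-++ʳ (x ∷ [])     ys {suc k} _ = refl
at-++ʳ (x ∷ y ∷ xs) ys {suc k} p = at-++ʳ (y ∷ xs) ys p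

at-++-∸ : ∀ xs ys {k} → length xs < k → at (xs ++ ys) k ≡ at ys (k ∸ length xs)
at-++-∸ xs ys xs<k = trans (cong (at (xs ++ ys)) (sym (m+[n∸m]≡n (<⇒≤ xs<k)))) (at-++ʳ xs ys (m<n⇒0<n∸m xs<k))

at-++-split : ∀ xs ys {k} → 1 ≤ k → k ≤ length (xs ++ ys) →
  (k ≤ length xs × at (xs ++ ys) k ∈ xs) ⊎ (length xs < k × at (xs ++ ys) k ∈ ys)
at-++-split xs ys {k} 1≤k k≤ with k ≤? length xs
... | yes k≤xs = inj₁ (k≤xs , subst (_∈ xs) (sym (at-++ˡ xs ys 1≤k k≤xs)) (at-∈ xs 1≤k k≤xs))
... | no k≰xs  = inj₂ (xs<k , subst (_∈ ys) (sym (at-++-∸ xs ys xs<k)) (at-∈ ys (m<n⇒0<n∸m xs<k) k∸xs≤ys))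
  where
  xs<k = ≰⇒> k≰xs
  k∸xs≤ys = m≤n+o⇒m∸n≤o k (length xs) (subst (k ≤_) (length-++ xs) k≤)

at-map : ∀ (f : ℕ → ℕ) xs k → f 0 ≡ 0 → at (map f xs) k ≡ f (at xs k)
at-map f []       k             f0 = sym f0
at-map f (x ∷ xs) zero          f0 = sym f0
at-map f (x ∷ xs) (suc zero)    f0 = refl
at-map f (x ∷ xs) (suc (suc k)) f0 = at-map f xs (suc k) f0

at⇒All : ∀ {P : ℕ → Set} xs → (∀ k → 1 ≤ k → k ≤ length xs → P (at xs k)) → All P xs
at⇒All []       h = []
at⇒All (x ∷ xs) h = h 1 z<s z<s ∷ at⇒All xs λ { (suc k) _ k≤ → h (suc (suc k)) z<s (s≤s k≤) }

Increasing : List ℕ → Set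
Increasing = AllPairs _<_

at<⇒Increasing : ∀ xs → (∀ i j → 1 ≤ i → i < j → j ≤ length xs → at xs i < at xs j) → Increasing xs
at<⇒Increasing []       h = []
at<⇒Increasing (x ∷ xs) h =
  at⇒All xs (λ { (suc j) _ j≤ → h 1 (suc (suc j)) z<s (s≤s z<s) (s≤s j≤) }) ∷
  at<⇒Increasing xs (λ { (suc i) (suc j) _ (s≤s i<j) j≤ →
    h (suc (suc i)) (suc (suc j)) z<s (s≤s (s≤s i<j)) (s≤s j≤) })

Increasing⇒at< : ∀ {xs} → Increasing xs → ∀ i j → 1 ≤ i → i < j → j ≤ length xs → at xs i < at xs j
Increasing⇒at< {[]}     _         _             zero          _ ()        _
Increasing⇒at< {[]}     _         _             (suc _)       _ _         ()
Increasing⇒at< {x ∷ xs} _         (suc zero)    (suc zero)    _ (s≤s ()) _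
Increasing⇒at< {x ∷ xs} (x< ∷ _)  (suc zero)    (suc (suc j)) _ _         (s≤s j≤) =
  All.lookup x< (at-∈ xs z<s j≤)
Increasing⇒at< {x ∷ xs} (_ ∷ inc) (suc (suc i)) (suc (suc j)) _ (s≤s i<j) (s≤s j≤) =
  Increasing⇒at< inc (suc i) (suc j) z<s i<j j≤

Blockwise : ℕ → ℕ → List ℕ → Set
Blockwise n m γ = (∀ i j → 1 ≤ i → i < j → j ≤ n → at γ i < at γ j) ×
                  (∀ i j → n < i → i < j → j ≤ n + m → at γ i < at γ j)

Blockwise-++ : ∀ α β → Blockwise (length α) (length β) (α ++ β) ⇔ (Increasing α × Increasing β)
Blockwise-++ α β = mk⇔ to from
  where
  n = length α
  to : Blockwise n (length β) (α ++ β) → Increasing α × Increasing β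
  to (incα , incβ) =
    at<⇒Increasing α (λ i j 1≤i i<j j≤ →
      subst₂ _<_ (at-++ˡ α β 1≤i (≤-trans (<⇒≤ i<j) j≤)) (at-++ˡ α β (≤-trans 1≤i (<⇒≤ i<j)) j≤)
        (incα i j 1≤i i<j j≤)) ,
    at<⇒Increasing β (λ i j 1≤i i<j j≤ →
      subst₂ _<_ (at-++ʳ α β 1≤i) (at-++ʳ α β (≤-trans 1≤i (<⇒≤ i<j)))
        (incβ (n + i) (n + j) (subst (_< n + i) (+-identityʳ n) (+-monoʳ-< n 1≤i))
          (+-monoʳ-< n i<j) (+-monoʳ-≤ n j≤)))
  from : Increasing α × Increasing β → Blockwise n (length β) (α ++ β)
  from (incα , incβ) =
    (λ i j 1≤i i<j j≤ →
      subst₂ _<_ (sym (at-++ˡ α β 1≤i (≤-trans (<⇒≤ i<j) j≤)))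
                 (sym (at-++ˡ α β (≤-trans 1≤i (<⇒≤ i<j)) j≤))
        (Increasing⇒at< incα i j 1≤i i<j j≤)) ,
    (λ i j n<i i<j j≤ →
      subst₂ _<_ (sym (at-++-∸ α β n<i)) (sym (at-++-∸ α β (<-trans n<i i<j)))
        (Increasing⇒at< incβ (i ∸ n) (j ∸ n) (m<n⇒0<n∸m n<i) (∸-monoˡ-< i<j (<⇒≤ n<i))
          (m≤n+o⇒m∸n≤o j n j≤)))

t-≤ : ∀ {i j} → j ≤ i → t i j ≡ j
t-≤ {i} {j} j≤i with j ≤? i
... | yes _   = refl
... | no j≰i = ⊥-elim (j≰i j≤i)

t-> : ∀ {i j} → i < j → t i j ≡ j ∸ 1
t-> {i} {j} i<j with j ≤? i
... | yes j≤i = ⊥-elim (<⇒≱ i<j j≤i)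
... | no _    = refl

t-mono-≤ : ∀ i {a b} → a ≤ b → t i a ≤ t i b
t-mono-≤ i {a} {b} a≤b with ≤-<-connex b i | ≤-<-connex a i
... | inj₁ b≤i | _        = subst₂ _≤_ (sym (t-≤ (≤-trans a≤b b≤i))) (sym (t-≤ b≤i)) a≤b
... | inj₂ i<b | inj₂ i<a = subst₂ _≤_ (sym (t-> i<a)) (sym (t-> i<b)) (∸-monoˡ-≤ 1 a≤b)
t-mono-≤ i {a} {suc b} a≤b | inj₂ (s≤s i≤b) | inj₁ a≤i =
  subst₂ _≤_ (sym (t-≤ a≤i)) (sym (t-> (s≤s i≤b))) (≤-trans a≤i i≤b)

t-reflects-< : ∀ i {a b} → t i a < t i b → a < b
t-reflects-< i {a} {b} lt with a <? b
... | yes a<b = a<b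
... | no a≮b  = ⊥-elim (<⇒≱ lt (t-mono-≤ i (≮⇒≥ a≮b)))

t-preserves-< : ∀ i {a b} → a < b → ¬ (a ≡ i × b ≡ suc i) → t i a < t i b
t-preserves-< i {a} {b} a<b not-glued with ≤-<-connex b i | ≤-<-connex a i
... | inj₁ b≤i | _        = subst₂ _<_ (sym (t-≤ (≤-trans (<⇒≤ a<b) b≤i))) (sym (t-≤ b≤i)) a<b
... | inj₂ i<b | inj₂ i<a = subst₂ _<_ (sym (t-> i<a)) (sym (t-> i<b)) (∸-monoˡ-< a<b (≤-trans z<s i<a))
t-preserves-< i {a} {suc b} (s≤s a≤b) not-glued | inj₂ (s≤s i≤b) | inj₁ a≤i with m≤n⇒m<n∨m≡n a≤b
... | inj₁ a<b  = subst₂ _<_ (sym (t-≤ a≤i)) (sym (t-> (s≤s i≤b))) a<b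
... | inj₂ refl = ⊥-elim (not-glued (≤-antisym a≤i i≤b , cong suc (≤-antisym a≤i i≤b)))

at-t : ∀ i γ k → at (map (t i) γ) k ≡ t i (at γ k)
at-t i γ k = at-map (t i) γ k (t-≤ {i} z≤n)

t-reflects-at< : ∀ i γ {p q} → at (map (t i) γ) p < at (map (t i) γ) q → at γ p < at γ q
t-reflects-at< i γ {p} {q} lt = t-reflects-< i (subst₂ _<_ (at-t i γ p) (at-t i γ q) lt)

t-preserves-at< : ∀ i γ {p q} → ¬ (at γ p ≡ i × at γ q ≡ suc i) →
  at γ p < at γ q → at (map (t i) γ) p < at (map (t i) γ) q
t-preserves-at< i γ {p} {q} not-glued lt =
  subst₂ _<_ (sym (at-t i γ p)) (sym (at-t i γ q)) (t-preserves-< i lt not-glued)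

-- Ascents and descents along the weak order

record _⊑[_]_ (γ : List ℕ) (N : ℕ) (δ : List ℕ) : Set where
  field
    ascent  : ∀ {p q} → 1 ≤ p → p < q → q ≤ N → at δ p < at δ q → at γ p < at γ q
    descent : ∀ {p q} → 1 ≤ p → p < q → q ≤ N → at γ q < at γ p → at δ q < at δ p
open _⊑[_]_

⊑-refl : ∀ {N γ} → γ ⊑[ N ] γ
⊑-refl = record { ascent = λ _ _ _ lt → lt ; descent = λ _ _ _ lt → lt }

⊑-trans : ∀ {N γ δ ε} → γ ⊑[ N ] δ → δ ⊑[ N ] ε → γ ⊑[ N ] ε
⊑-trans γ⊑δ δ⊑ε = record
  { ascent  = λ 1≤p p<q q≤N lt → ascent γ⊑δ 1≤p p<q q≤N (ascent δ⊑ε 1≤p p<q q≤N lt)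
  ; descent = λ 1≤p p<q q≤N lt → descent δ⊑ε 1≤p p<q q≤N (descent γ⊑δ 1≤p p<q q≤N lt)
  }

BStep⇒⊑ : ∀ {N γ δ} → BStep N γ δ → γ ⊑[ N ] δ
BStep⇒⊑ (up {γ} {i = i} _ _ _ before) = record
  { ascent  = λ _ _ _ → t-reflects-at< i γ
  ; descent = λ 1≤p p<q q≤N → t-preserves-at< i γ λ (γq≡i , γp≡1+i) →
      <-asym p<q (before _ _ (≤-trans 1≤p (<⇒≤ p<q)) q≤N 1≤p (≤-trans (<⇒≤ p<q) q≤N) γq≡i γp≡1+i)
  }
BStep⇒⊑ (down {γ} {i = i} _ _ _ before) = record
  { ascent  = λ 1≤p p<q q≤N → t-preserves-at< i γ λ (γp≡i , γq≡1+i) →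
      <-asym p<q (before _ _ (≤-trans 1≤p (<⇒≤ p<q)) q≤N 1≤p (≤-trans (<⇒≤ p<q) q≤N) γq≡1+i γp≡i)
  ; descent = λ _ _ _ → t-reflects-at< i γ
  }

≤B⇒⊑ : ∀ {N γ δ} → γ ≤B[ N ] δ → γ ⊑[ N ] δ
≤B⇒⊑ = fold _ (λ step rest → ⊑-trans (BStep⇒⊑ step) rest) ⊑-refl

Blockwise-⊑ : ∀ {n m γ δ} → γ ⊑[ n + m ] δ → Blockwise n m δ → Blockwise n m γ
Blockwise-⊑ {n} {m} γ⊑δ (incˡ , incʳ) =
  (λ i j 1≤i i<j j≤n → ascent γ⊑δ 1≤i i<j (≤-trans j≤n (m≤m+n n m)) (incˡ i j 1≤i i<j j≤n)) ,
  (λ i j n<i i<j j≤ → ascent γ⊑δ (≤-trans z<s n<i) i<j j≤ (incʳ i j n<i i<j j≤))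

-- Words and their shuffles

data Side : Set where
  left right : Side

data Letter : Set where
  L R LR : Letter

Word : Set
Word = List Letter

occurs : Side → Letter → Bool
occurs left  L  = true
occurs left  R  = false
occurs left  LR = true
occurs right L  = false
occurs right R  = true
occurs right LR = true

positions : Side → ℕ → Word → List ℕ
positions s k []      = []
positions s k (x ∷ w) = if occurs s x then k ∷ positions s (suc k) w else positions s (suc k) w

shuffleOf : Word → List ℕ
shuffleOf w = positions left 1 w ++ positions right 1 w

count : Side → Word → ℕ
count s []      = 0
count s (x ∷ w) = if occurs s x then suc (count s w) else count s w

length-positions : ∀ s k w → length (positions s k w) ≡ count s w
length-positions s k []      = refl
length-positions s k (x ∷ w) with occurs s x
... | true  = cong suc (length-positions s (suc k) w)
... | false = length-positions s (suc k) w

count-++ : ∀ s u v → count s (u ++ v) ≡ count s u + count s v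
count-++ s []      v = refl
count-++ s (x ∷ u) v with occurs s x
... | true  = cong suc (count-++ s u v)
... | false = count-++ s u v

positions-++ : ∀ s k u v → positions s k (u ++ v) ≡ positions s k u ++ positions s (k + length u) v
positions-++ s k []      v = cong (λ j → positions s j v) (sym (+-identityʳ k))
positions-++ s k (x ∷ u) v with occurs s x
... | true  = cong (k ∷_) (trans (positions-++ s (suc k) u v) shift)
  where shift = cong (λ j → positions s (suc k) u ++ positions s j v) (sym (+-suc k (length u)))
... | false = trans (positions-++ s (suc k) u v) shift
  where shift = cong (λ j → positions s (suc k) u ++ positions s j v) (sym (+-suc k (length u)))

InRange : ℕ → ℕ → ℕ → Set
InRange k l v = k ≤ v × v < k + l

InRange-suc : ∀ {k l v} → InRange (suc k) l v → InRange k (suc l) v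
InRange-suc {k} {l} {v} (k<v , v<) = <⇒≤ k<v , subst (v <_) (sym (+-suc k l)) v<

InRange-tail : ∀ {k l v} → InRange k (suc l) v → k ≢ v → InRange (suc k) l v
InRange-tail {k} {l} {v} (k≤v , v<) k≢v = ≤∧≢⇒< k≤v k≢v , subst (v <_) (+-suc k l) v<

positions-InRange : ∀ s k w → All (InRange k (length w)) (positions s k w)
positions-InRange s k []      = []
positions-InRange s k (x ∷ w) with occurs s x
... | true  = (≤-refl , m<m+n k z<s) ∷ All.map InRange-suc (positions-InRange s (suc k) w)
... | false = All.map InRange-suc (positions-InRange s (suc k) w)

positions-Increasing : ∀ s k w → Increasing (positions s k w)
positions-Increasing s k []      = []
positions-Increasing s k (x ∷ w) with occurs s x
... | true  = All.map proj₁ (positions-InRange s (suc k) w) ∷ positions-Increasing s (suc k) w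
... | false = positions-Increasing s (suc k) w

positions-cover : ∀ k w {v} → InRange k (length w) v → v ∈ positions left k w ⊎ v ∈ positions right k w
positions-cover k []      {v} (k≤v , v<) = ⊥-elim (<⇒≱ v< (subst (_≤ v) (sym (+-identityʳ k)) k≤v))
positions-cover k (x ∷ w) {v} (k≤v , v<) with m≤n⇒m<n∨m≡n k≤v
... | inj₂ refl = head x
  where
  head : ∀ x → k ∈ positions left k (x ∷ w) ⊎ k ∈ positions right k (x ∷ w)
  head L  = inj₁ (here refl)
  head R  = inj₂ (here refl)
  head LR = inj₁ (here refl)
... | inj₁ k<v = tail x (positions-cover (suc k) w (k<v , subst (v <_) (+-suc k (length w)) v<))
  where
  tail : ∀ x → v ∈ positions left (suc k) w ⊎ v ∈ positions right (suc k) w →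
         v ∈ positions left k (x ∷ w) ⊎ v ∈ positions right k (x ∷ w)
  tail L  (inj₁ v∈) = inj₁ (there v∈)
  tail L  (inj₂ v∈) = inj₂ v∈
  tail R  (inj₁ v∈) = inj₁ v∈
  tail R  (inj₂ v∈) = inj₂ (there v∈)
  tail LR (inj₁ v∈) = inj₁ (there v∈)
  tail LR (inj₂ v∈) = inj₂ (there v∈)

shuffleOf-IsP : ∀ w → IsP (length (shuffleOf w)) (length w) (shuffleOf w)
shuffleOf-IsP w = refl , bounded , onto
  where
  γ = shuffleOf w
  inRange : All (InRange 1 (length w)) γ
  inRange = ++⁺ (positions-InRange left 1 w) (positions-InRange right 1 w)
  bounded : ∀ k → 1 ≤ k → k ≤ length γ → (1 ≤ at γ k) × (at γ k ≤ length w)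
  bounded k 1≤k k≤ with All.lookup inRange (at-∈ γ 1≤k k≤)
  ... | 1≤v , s≤s v≤ = 1≤v , v≤
  onto : ∀ v → 1 ≤ v → v ≤ length w → ∃ λ k → (1 ≤ k) × (k ≤ length γ) × (at γ k ≡ v)
  onto v 1≤v v≤ with positions-cover 1 w (1≤v , s≤s v≤)
  ... | inj₁ v∈ = ∈⇒at γ (∈-++⁺ˡ v∈)
  ... | inj₂ v∈ = ∈⇒at γ (∈-++⁺ʳ (positions left 1 w) v∈)

shuffleOf-Blockwise : ∀ w → Blockwise (count left w) (count right w) (shuffleOf w)
shuffleOf-Blockwise w =
  subst₂ (λ n m → Blockwise n m (shuffleOf w)) (length-positions left 1 w) (length-positions right 1 w)
    (Equivalence.from (Blockwise-++ (positions left 1 w) (positions right 1 w))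
      (positions-Increasing left 1 w , positions-Increasing right 1 w))

-- Weak-order steps between words

t-positions-shift : ∀ s {i j} w → i ≤ j → map (t i) (positions s (suc j) w) ≡ positions s j w
t-positions-shift s []      i≤j = refl
t-positions-shift s (x ∷ w) i≤j with occurs s x
... | true  = cong₂ _∷_ (t-> (s≤s i≤j)) (t-positions-shift s w (m≤n⇒m≤1+n i≤j))
... | false = t-positions-shift s w (m≤n⇒m≤1+n i≤j)

map-t-≤ : ∀ {i} xs → All (_≤ i) xs → map (t i) xs ≡ xs
map-t-≤ []       []           = refl
map-t-≤ (x ∷ xs) (x≤i ∷ xs≤i) = cong₂ _∷_ (t-≤ x≤i) (map-t-≤ xs xs≤i)

data Opposite : Letter → Letter → Set where
  L-R : Opposite L R
  R-L : Opposite R L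

t-glues-head : ∀ s j {x y} q → Opposite x y →
  map (t j) (positions s j (x ∷ y ∷ q)) ≡ positions s j (LR ∷ q)
t-glues-head left  j q L-R = cong₂ _∷_ (t-≤ ≤-refl) (t-positions-shift left q (n≤1+n j))
t-glues-head right j q L-R = cong₂ _∷_ (t-> ≤-refl) (t-positions-shift right q (n≤1+n j))
t-glues-head left  j q R-L = cong₂ _∷_ (t-> ≤-refl) (t-positions-shift left q (n≤1+n j))
t-glues-head right j q R-L = cong₂ _∷_ (t-≤ ≤-refl) (t-positions-shift right q (n≤1+n j))

t-glues-positions : ∀ s p {x y} q → Opposite x y →
  map (t (suc (length p))) (positions s 1 (p ++ x ∷ y ∷ q)) ≡ positions s 1 (p ++ LR ∷ q)
t-glues-positions s p {x} {y} q opp = begin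
  map (t i) (positions s 1 (p ++ x ∷ y ∷ q))               ≡⟨ cong (map (t i)) (positions-++ s 1 p (x ∷ y ∷ q)) ⟩
  map (t i) (positions s 1 p ++ positions s i (x ∷ y ∷ q)) ≡⟨ map-++ (t i) (positions s 1 p) _ ⟩
  map (t i) (positions s 1 p) ++ map (t i) (positions s i (x ∷ y ∷ q))
    ≡⟨ cong₂ _++_ (map-t-≤ _ (All.map (λ (_ , v<) → <⇒≤ v<) (positions-InRange s 1 p))) (t-glues-head s i q opp) ⟩
  positions s 1 p ++ positions s i (LR ∷ q)                ≡⟨ positions-++ s 1 p (LR ∷ q) ⟨
  positions s 1 (p ++ LR ∷ q)                              ∎
  where
  open ≡-Reasoning
  i = suc (length p)

t-glues : ∀ p {x y} q → Opposite x y →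
  map (t (suc (length p))) (shuffleOf (p ++ x ∷ y ∷ q)) ≡ shuffleOf (p ++ LR ∷ q)
t-glues p {x} {y} q opp =
  trans (map-++ _ (positions left 1 (p ++ x ∷ y ∷ q)) _)
    (cong₂ _++_ (t-glues-positions left p q opp) (t-glues-positions right p q opp))

length-glues : ∀ p {x y} q → Opposite x y →
  length (shuffleOf (p ++ x ∷ y ∷ q)) ≡ length (shuffleOf (p ++ LR ∷ q))
length-glues p {x} {y} q opp =
  trans (sym (length-map (t (suc (length p))) (shuffleOf (p ++ x ∷ y ∷ q)))) (cong length (t-glues p q opp))

∉-positions : ∀ s p {x} q → occurs s x ≡ false → suc (length p) ∉ positions s 1 (p ++ x ∷ q)
∉-positions s p {x} q absent i∈ with ∈-++⁻ (positions s 1 p) (subst (_ ∈_) (positions-++ s 1 p (x ∷ q)) i∈)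
... | inj₁ i∈p = <-irrefl refl (proj₂ (All.lookup (positions-InRange s 1 p) i∈p))
... | inj₂ i∈xq rewrite absent =
  <-irrefl refl (proj₁ (All.lookup (positions-InRange s (suc (suc (length p))) q) i∈xq))

∉-positions-next : ∀ s p y {x} q → occurs s x ≡ false →
  suc (suc (length p)) ∉ positions s 1 (p ++ y ∷ x ∷ q)
∉-positions-next s p y q absent =
  subst₂ (λ i w → i ∉ positions s 1 w) (cong suc (trans (length-++ p) (+-comm (length p) 1))) (++-assoc p [ y ] _)
    (∉-positions s (p ++ [ y ]) q absent)

shuffleOf-Before : ∀ {N} w {a b} → length (shuffleOf w) ≡ N →
  a ∉ positions right 1 w → b ∉ positions left 1 w → Before N (shuffleOf w) a b
shuffleOf-Before w refl a∉ b∉ p q 1≤p p≤ 1≤q q≤ γp≡a γq≡b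
  with at-++-split (positions left 1 w) (positions right 1 w) 1≤p p≤
     | at-++-split (positions left 1 w) (positions right 1 w) 1≤q q≤
... | inj₂ (_ , a∈) | _             = ⊥-elim (a∉ (subst (_∈ _) γp≡a a∈))
... | inj₁ _        | inj₁ (_ , b∈) = ⊥-elim (b∉ (subst (_∈ _) γq≡b b∈))
... | inj₁ (p≤ , _) | inj₂ (<q , _) = ≤-<-trans p≤ <q

infix 4 _⟶_ _≤W_

data _⟶_ : Word → Word → Set where
  merge : ∀ p q → p ++ L ∷ R ∷ q ⟶ p ++ LR ∷ q
  split : ∀ p q → p ++ LR ∷ q ⟶ p ++ R ∷ L ∷ q

_≤W_ : Word → Word → Set
_≤W_ = Star _⟶_

suc-length<length : ∀ p (x y : Letter) q → suc (length p) < length (p ++ x ∷ y ∷ q)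
suc-length<length []      x y q = s≤s z<s
suc-length<length (_ ∷ p) x y q = s≤s (suc-length<length p x y q)

⟶-length : ∀ {w w′} → w ⟶ w′ → length (shuffleOf w) ≡ length (shuffleOf w′)
⟶-length (merge p q) = length-glues p q L-R
⟶-length (split p q) = sym (length-glues p q R-L)

⟶⇒BStep : ∀ {w w′} → w ⟶ w′ → BStep (length (shuffleOf w)) (shuffleOf w) (shuffleOf w′)
⟶⇒BStep (merge p q) =
  subst (BStep _ _) (t-glues p q L-R)
    (up (shuffleOf-IsP (p ++ L ∷ R ∷ q)) z<s (suc-length<length p L R q)
      (shuffleOf-Before (p ++ L ∷ R ∷ q) refl (∉-positions right p (R ∷ q) refl) (∉-positions-next left p L q refl)))
⟶⇒BStep (split p q) =
  subst (λ γ → BStep (length (shuffleOf (p ++ LR ∷ q))) γ (shuffleOf w′)) (t-glues p q R-L)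
    (down (subst (λ N → IsP N (length w′) (shuffleOf w′)) len (shuffleOf-IsP w′)) z<s (suc-length<length p R L q)
      (shuffleOf-Before w′ len (∉-positions-next right p R q refl) (∉-positions left p (L ∷ q) refl)))
  where
  w′ = p ++ R ∷ L ∷ q
  len = sym (⟶-length (split p q))

≤W⇒≤B : ∀ {w w′} → w ≤W w′ → shuffleOf w ≤B[ length (shuffleOf w) ] shuffleOf w′
≤W⇒≤B ε              = ε
≤W⇒≤B (step ◅ steps) = ⟶⇒BStep step ◅ subst (λ N → _ ≤B[ N ] _) (sym (⟶-length step)) (≤W⇒≤B steps)

≤W-length : ∀ {w w′} → w ≤W w′ → length (shuffleOf w) ≡ length (shuffleOf w′)
≤W-length = fold _ (λ step eq → trans (⟶-length step) eq) refl

⟶-∷ : ∀ x {w w′} → w ⟶ w′ → x ∷ w ⟶ x ∷ w′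
⟶-∷ x (merge p q) = merge (x ∷ p) q
⟶-∷ x (split p q) = split (x ∷ p) q

⟶-++ʳ : ∀ z {w w′} → w ⟶ w′ → w ++ z ⟶ w′ ++ z
⟶-++ʳ z (merge p q) =
  subst₂ _⟶_ (sym (++-assoc p (L ∷ R ∷ q) z)) (sym (++-assoc p (LR ∷ q) z)) (merge p (q ++ z))
⟶-++ʳ z (split p q) =
  subst₂ _⟶_ (sym (++-assoc p (LR ∷ q) z)) (sym (++-assoc p (R ∷ L ∷ q) z)) (split p (q ++ z))

≤W-∷ : ∀ x {w w′} → w ≤W w′ → x ∷ w ≤W x ∷ w′
≤W-∷ x = gmap (x ∷_) (⟶-∷ x)

≤W-++ʳ : ∀ z {w w′} → w ≤W w′ → w ++ z ≤W w′ ++ z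
≤W-++ʳ z = gmap (_++ z) (⟶-++ʳ z)

L-passes-R* : ∀ b q → L ∷ replicate b R ++ q ≤W replicate b R ++ L ∷ q
L-passes-R* zero    q = ε
L-passes-R* (suc b) q = merge [] _ ◅ split [] _ ◅ ≤W-∷ R (L-passes-R* b q)

R-passes-L* : ∀ a q → replicate a L ++ R ∷ q ≤W R ∷ replicate a L ++ q
R-passes-L* zero    q = ε
R-passes-L* (suc a) q = ≤W-∷ L (R-passes-L* a q) ◅◅ merge [] _ ◅ split [] _ ◅ ε

≤W-top : ∀ w → w ≤W replicate (count right w) R ++ replicate (count left w) L
≤W-top []       = ε
≤W-top (L ∷ w)  = ≤W-∷ L (≤W-top w) ◅◅ L-passes-R* (count right w) _
≤W-top (R ∷ w)  = ≤W-∷ R (≤W-top w)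
≤W-top (LR ∷ w) = ≤W-∷ LR (≤W-top w) ◅◅ split [] _ ◅ ≤W-∷ R (L-passes-R* (count right w) _)

≤W-bottom : ∀ w → replicate (count left w) L ++ replicate (count right w) R ≤W w
≤W-bottom []       = ε
≤W-bottom (L ∷ w)  = ≤W-∷ L (≤W-bottom w)
≤W-bottom (R ∷ w)  = R-passes-L* (count left w) _ ◅◅ ≤W-∷ R (≤W-bottom w)
≤W-bottom (LR ∷ w) = ≤W-∷ L (R-passes-L* (count left w) _) ◅◅ merge [] _ ◅ ≤W-∷ LR (≤W-bottom w)

-- Decoding a shuffle

range : ℕ → ℕ → List ℕ
range k zero    = []
range k (suc l) = k ∷ range (suc k) l

positions-tabulate : ∀ s (f : ℕ → Letter) k l {α} → Increasing α → All (InRange k l) α →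
  (∀ {v} → InRange k l v → (occurs s (f v) ≡ true) ⇔ v ∈ α) → positions s k (map f (range k l)) ≡ α
positions-tabulate s f k zero    {[]}    _ _                 _ = refl
positions-tabulate s f k zero    {v ∷ _} _ ((k≤v , v<) ∷ _) _ =
  ⊥-elim (<⇒≱ v< (subst (_≤ v) (sym (+-identityʳ k)) k≤v))
positions-tabulate s f k (suc l) {α} inc inR spec with occurs s (f k) in occ
... | true  = starts-with-k α inc inR spec (Equivalence.to (spec (≤-refl , m<m+n k z<s)) occ)
  where
  starts-with-k : ∀ α → Increasing α → All (InRange k (suc l)) α →
    (∀ {v} → InRange k (suc l) v → (occurs s (f v) ≡ true) ⇔ v ∈ α) →
    k ∈ α → k ∷ positions s (suc k) (map f (range (suc k) l)) ≡ α
  starts-with-k (x ∷ α) (x< ∷ _)   ((k≤x , _) ∷ _) _    (there k∈)  = ⊥-elim (<⇒≱ (All.lookup x< k∈) k≤x)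
  starts-with-k (x ∷ α) (k< ∷ inc) (_ ∷ inR)       spec (here refl) =
    cong (k ∷_) (positions-tabulate s f (suc k) l inc
      (All.zipWith (λ (k<v , v∈) → InRange-tail v∈ (<⇒≢ k<v)) (k< , inR))
      (λ v∈ → mk⇔ (λ o → drop-k v∈ (Equivalence.to (spec (InRange-suc v∈)) o))
                  (λ v∈α → Equivalence.from (spec (InRange-suc v∈)) (there v∈α))))
    where
    drop-k : ∀ {v} → InRange (suc k) l v → v ∈ k ∷ α → v ∈ α
    drop-k (k<k , _) (here refl) = ⊥-elim (<-irrefl refl k<k)
    drop-k _         (there v∈)  = v∈
... | false = positions-tabulate s f (suc k) l inc
  (All.tabulate (λ v∈ → InRange-tail (All.lookup inR v∈) λ { refl → k∉ v∈ }))
  (λ v∈ → spec (InRange-suc v∈))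
  where
  k∉ : k ∉ α
  k∉ k∈ with () ← trans (sym (Equivalence.from (spec (≤-refl , m<m+n k z<s)) k∈)) occ

letter : {P Q : Set} → Dec P → Dec Q → Letter
letter (yes _) (yes _) = LR
letter (yes _) (no _)  = L
letter (no _)  _       = R

occurs-left-letter : {P Q : Set} (P? : Dec P) (Q? : Dec Q) → (occurs left (letter P? Q?) ≡ true) ⇔ P
occurs-left-letter (yes p) (yes _) = mk⇔ (λ _ → p) (λ _ → refl)
occurs-left-letter (yes p) (no _)  = mk⇔ (λ _ → p) (λ _ → refl)
occurs-left-letter (no ¬p) _       = mk⇔ (λ ()) (λ p → ⊥-elim (¬p p))

occurs-right-letter : {P Q : Set} (P? : Dec P) (Q? : Dec Q) → P ⊎ Q → (occurs right (letter P? Q?) ≡ true) ⇔ Q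
occurs-right-letter (yes _) (yes q) _        = mk⇔ (λ _ → q) (λ _ → refl)
occurs-right-letter (yes _) (no ¬q) _        = mk⇔ (λ ()) (λ q → ⊥-elim (¬q q))
occurs-right-letter (no ¬p) _       (inj₁ p) = ⊥-elim (¬p p)
occurs-right-letter (no _)  (yes q) (inj₂ _) = mk⇔ (λ _ → q) (λ _ → refl)
occurs-right-letter (no _)  (no ¬q) (inj₂ q) = ⊥-elim (¬q q)

word-of-blocks : ∀ {r} α β → Increasing α → Increasing β → All (InRange 1 r) (α ++ β) →
  (∀ {v} → InRange 1 r v → v ∈ α ⊎ v ∈ β) →
  Σ Word λ w → positions left 1 w ≡ α × positions right 1 w ≡ β
word-of-blocks {r} α β incα incβ inR cover =
  map f (range 1 r) ,
  positions-tabulate left  f 1 r incα (proj₁ (++⁻ α inR)) (λ {v} _ → occurs-left-letter (v ∈? α) (v ∈? β)) ,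
  positions-tabulate right f 1 r incβ (proj₂ (++⁻ α inR))
    (λ {v} v∈ → occurs-right-letter (v ∈? α) (v ∈? β) (cover v∈))
  where
  f : ℕ → Letter
  f v = letter (v ∈? α) (v ∈? β)

SH⇒word : ∀ {n m γ} → SH n m γ → Σ Word λ w → shuffleOf w ≡ γ × count left w ≡ n × count right w ≡ m
SH⇒word {n} {m} {γ} ((r , len , bounded , onto) , blockwise) =
  w , trans (cong₂ _++_ wα wβ) αβ≡γ ,
  trans (sym (length-positions left 1 w)) (trans (cong length wα) |α|) ,
  trans (sym (length-positions right 1 w)) (trans (cong length wβ) |β|)
  where
  α = take n γ
  β = drop n γ
  αβ≡γ : α ++ β ≡ γ
  αβ≡γ = take++drop≡id n γ
  |α| : length α ≡ n
  |α| = trans (length-take n γ) (trans (cong (n ⊓_) len) (m≤n⇒m⊓n≡m (m≤m+n n m)))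
  |β| : length β ≡ m
  |β| = trans (length-drop n γ) (trans (cong (_∸ n) len) (m+n∸m≡n n m))
  increasing : Increasing α × Increasing β
  increasing = Equivalence.to (Blockwise-++ α β)
    (subst₂ (λ n′ m′ → Blockwise n′ m′ (α ++ β)) (sym |α|) (sym |β|)
      (subst (Blockwise n m) (sym αβ≡γ) blockwise))
  inR : All (InRange 1 r) (α ++ β)
  inR = subst (All (InRange 1 r)) (sym αβ≡γ)
    (at⇒All γ λ k 1≤k k≤ → let (1≤γk , γk≤r) = bounded k 1≤k (subst (k ≤_) len k≤) in
      1≤γk , s≤s γk≤r)
  cover : ∀ {v} → InRange 1 r v → v ∈ α ⊎ v ∈ β
  cover {v} (1≤v , s≤s v≤r) with onto v 1≤v v≤r
  ... | k , 1≤k , k≤ , γk≡v =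
    ∈-++⁻ α (subst (v ∈_) (sym αβ≡γ) (subst (_∈ γ) γk≡v (at-∈ γ 1≤k (subst (k ≤_) (sym len) k≤))))
  decoded = word-of-blocks {r} α β (proj₁ increasing) (proj₂ increasing) inR cover
  w = proj₁ decoded
  wα = proj₁ (proj₂ decoded)
  wβ = proj₂ (proj₂ decoded)

lastPosition : Side → Word → ℕ
lastPosition s w = at (positions s 1 w) (count s w)

at-shuffleOf-left : ∀ w → 1 ≤ count left w → at (shuffleOf w) (count left w) ≡ lastPosition left w
at-shuffleOf-left w 1≤ =
  subst (λ k → at (shuffleOf w) k ≡ at (positions left 1 w) k) (length-positions left 1 w)
    (at-++ˡ (positions left 1 w) _ (subst (1 ≤_) (sym (length-positions left 1 w)) 1≤) ≤-refl)

at-shuffleOf-right : ∀ w → 1 ≤ count right w →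
  at (shuffleOf w) (count left w + count right w) ≡ lastPosition right w
at-shuffleOf-right w 1≤ =
  subst₂ (λ n m → at (shuffleOf w) (n + m) ≡ at (positions right 1 w) m)
    (length-positions left 1 w) (length-positions right 1 w)
    (at-++ʳ (positions left 1 w) _ (subst (1 ≤_) (sym (length-positions right 1 w)) 1≤))

lastPosition-occurs : ∀ s w z → occurs s z ≡ true → lastPosition s (w ∷ʳ z) ≡ suc (length w)
lastPosition-occurs s w z occ
  rewrite sym (length-positions s 1 (w ∷ʳ z)) | positions-++ s 1 w [ z ] | occ
        | length-++ (positions s 1 w) {[ suc (length w) ]} = at-++ʳ (positions s 1 w) _ z<s

lastPosition-absent : ∀ s w z → occurs s z ≡ false → 1 ≤ count s (w ∷ʳ z) →
  lastPosition s (w ∷ʳ z) < suc (length w)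
lastPosition-absent s w z absent 1≤
  rewrite sym (length-positions s 1 (w ∷ʳ z)) | positions-++ s 1 w [ z ] | absent | ++-identityʳ (positions s 1 w) =
  proj₂ (All.lookup (positions-InRange s 1 w) (at-∈ (positions s 1 w) 1≤ ≤-refl))

EndOrder : Letter → ℕ → ℕ → Set
EndOrder L  x y = y < x
EndOrder R  x y = x < y
EndOrder LR x y = x ≡ y

EndOrder-unique : ∀ z z′ {x y} → EndOrder z x y → EndOrder z′ x y → z ≡ z′
EndOrder-unique L  L  _   _   = refl
EndOrder-unique L  R  y<x x<y = ⊥-elim (<-asym y<x x<y)
EndOrder-unique L  LR y<x x≡y = ⊥-elim (<-irrefl (sym x≡y) y<x)
EndOrder-unique R  L  x<y y<x = ⊥-elim (<-asym y<x x<y)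
EndOrder-unique R  R  _   _   = refl
EndOrder-unique R  LR x<y x≡y = ⊥-elim (<-irrefl x≡y x<y)
EndOrder-unique LR L  x≡y y<x = ⊥-elim (<-irrefl (sym x≡y) y<x)
EndOrder-unique LR R  x≡y x<y = ⊥-elim (<-irrefl x≡y x<y)
EndOrder-unique LR LR _   _   = refl

shuffleOf-EndOrder : ∀ w z {n m} → count left (w ∷ʳ z) ≡ n → count right (w ∷ʳ z) ≡ m → 1 ≤ n → 1 ≤ m →
  EndOrder z (at (shuffleOf (w ∷ʳ z)) n) (at (shuffleOf (w ∷ʳ z)) (n + m))
shuffleOf-EndOrder w L refl refl 1≤n 1≤m =
  subst₂ _<_ (sym (at-shuffleOf-right (w ∷ʳ L) 1≤m)) (sym (at-shuffleOf-left (w ∷ʳ L) 1≤n))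
    (<-≤-trans (lastPosition-absent right w L refl 1≤m) (≤-reflexive (sym (lastPosition-occurs left w L refl))))
shuffleOf-EndOrder w R refl refl 1≤n 1≤m =
  subst₂ _<_ (sym (at-shuffleOf-left (w ∷ʳ R) 1≤n)) (sym (at-shuffleOf-right (w ∷ʳ R) 1≤m))
    (<-≤-trans (lastPosition-absent left w R refl 1≤n) (≤-reflexive (sym (lastPosition-occurs right w R refl))))
shuffleOf-EndOrder w LR refl refl 1≤n 1≤m =
  trans (at-shuffleOf-left (w ∷ʳ LR) 1≤n)
    (trans (lastPosition-occurs left w LR refl)
      (sym (trans (at-shuffleOf-right (w ∷ʳ LR) 1≤m) (lastPosition-occurs right w LR refl))))

top bottom : Letter → ℕ → ℕ → List ℕ
top    z a b = shuffleOf ((replicate b R ++ replicate a L) ∷ʳ z)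
bottom z a b = shuffleOf ((replicate a L ++ replicate b R) ∷ʳ z)

shuffleOf-between : ∀ w z → let a = count left w; b = count right w; N = length (shuffleOf (w ∷ʳ z)) in
  bottom z a b ≤B[ N ] shuffleOf (w ∷ʳ z) × shuffleOf (w ∷ʳ z) ≤B[ N ] top z a b
shuffleOf-between w z =
  subst (λ N → bottom z (count left w) (count right w) ≤B[ N ] shuffleOf (w ∷ʳ z))
    (≤W-length lower) (≤W⇒≤B lower) ,
  ≤W⇒≤B (≤W-++ʳ [ z ] (≤W-top w))
  where
  lower = ≤W-++ʳ [ z ] (≤W-bottom w)

count-init : ∀ s w z {a} → count s (w ∷ʳ z) ≡ count s [ z ] + a → count s w ≡ a
count-init s w z eq =
  +-cancelˡ-≡ (count s [ z ]) _ _ (trans (+-comm _ (count s w)) (trans (sym (count-++ s w [ z ])) eq))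

-- Writing n as count left [ z ] + a rather than a + count left [ z ] lets it compute to a or suc a
-- once z is known, which is what the three cases below need.
SH⇒between : ∀ z a b {γ} → let n = count left [ z ] + a; m = count right [ z ] + b in 1 ≤ n → 1 ≤ m →
  SH n m γ → EndOrder z (at γ n) (at γ (n + m)) → bottom z a b ≤B[ n + m ] γ × γ ≤B[ n + m ] top z a b
SH⇒between z a b {γ} 1≤n 1≤m sh end with SH⇒word {γ = γ} sh
... | w , refl , cl , cr with initLast w
...   | [] with () ← subst (1 ≤_) (sym cl) 1≤n
...   | w₀ ∷ʳ′ z′
  with refl ← EndOrder-unique z′ z (shuffleOf-EndOrder w₀ z′ cl cr 1≤n 1≤m) end
  with refl ← count-init left w₀ z cl | refl ← count-init right w₀ z cr
  = subst (λ N → bottom z a b ≤B[ N ] shuffleOf (w₀ ∷ʳ z) × shuffleOf (w₀ ∷ʳ z) ≤B[ N ] top z a b)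
      (proj₁ (proj₂ (proj₁ sh))) (shuffleOf-between w₀ z)

count-replicate : ∀ s x k → count s (replicate k x) ≡ (if occurs s x then k else 0)
count-replicate s x zero    with occurs s x
... | true  = refl
... | false = refl
count-replicate s x (suc k) with occurs s x in occ
... | true  = cong suc (trans (count-replicate s x k) (cong (λ o → if o then k else 0) occ))
... | false = trans (count-replicate s x k) (cong (λ o → if o then k else 0) occ)

count-blocks : ∀ s x k y l z → count s ((replicate k x ++ replicate l y) ∷ʳ z) ≡
  count s [ z ] + ((if occurs s x then k else 0) + (if occurs s y then l else 0))
count-blocks s x k y l z = begin
  count s ((replicate k x ++ replicate l y) ∷ʳ z)          ≡⟨ count-++ s (replicate k x ++ replicate l y) [ z ] ⟩
  count s (replicate k x ++ replicate l y) + count s [ z ] ≡⟨ +-comm _ (count s [ z ]) ⟩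
  count s [ z ] + count s (replicate k x ++ replicate l y)
    ≡⟨ cong (count s [ z ] +_) (count-++ s (replicate k x) _) ⟩
  count s [ z ] + (count s (replicate k x) + count s (replicate l y))
    ≡⟨ cong (count s [ z ] +_) (cong₂ _+_ (count-replicate s x k) (count-replicate s y l)) ⟩
  count s [ z ] + ((if occurs s x then k else 0) + (if occurs s y then l else 0)) ∎
  where open ≡-Reasoning

count-top : ∀ z a b → count left  ((replicate b R ++ replicate a L) ∷ʳ z) ≡ count left [ z ] + a ×
                      count right ((replicate b R ++ replicate a L) ∷ʳ z) ≡ count right [ z ] + b
count-top z a b =
  count-blocks left R b L a z , trans (count-blocks right R b L a z) (cong (count right [ z ] +_) (+-identityʳ b))

count-bottom : ∀ z a b → count left  ((replicate a L ++ replicate b R) ∷ʳ z) ≡ count left [ z ] + a ×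
                         count right ((replicate a L ++ replicate b R) ∷ʳ z) ≡ count right [ z ] + b
count-bottom z a b =
  trans (count-blocks left L a R b z) (cong (count left [ z ] +_) (+-identityʳ a)) , count-blocks right L a R b z

top-EndOrder : ∀ z a b → let n = count left [ z ] + a; m = count right [ z ] + b in 1 ≤ n → 1 ≤ m →
  EndOrder z (at (top z a b) n) (at (top z a b) (n + m))
top-EndOrder z a b =
  shuffleOf-EndOrder (replicate b R ++ replicate a L) z (proj₁ (count-top z a b)) (proj₂ (count-top z a b))

bottom-EndOrder : ∀ z a b → let n = count left [ z ] + a; m = count right [ z ] + b in 1 ≤ n → 1 ≤ m →
  EndOrder z (at (bottom z a b) n) (at (bottom z a b) (n + m))
bottom-EndOrder z a b =
  shuffleOf-EndOrder (replicate a L ++ replicate b R) z (proj₁ (count-bottom z a b)) (proj₂ (count-bottom z a b))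

≤B-top⇒SH : ∀ z a b {γ} → let n = count left [ z ] + a; m = count right [ z ] + b in
  InP (n + m) γ → γ ≤B[ n + m ] top z a b → SH n m γ
≤B-top⇒SH z a b γ∈P γ≤top =
  γ∈P , Blockwise-⊑ (≤B⇒⊑ γ≤top)
          (subst₂ (λ n m → Blockwise n m (top z a b)) (proj₁ (count-top z a b)) (proj₂ (count-top z a b))
            (shuffleOf-Blockwise ((replicate b R ++ replicate a L) ∷ʳ z)))

-- Closed forms of the bounds

length-range : ∀ k l → length (range k l) ≡ l
length-range k zero    = refl
length-range k (suc l) = cong suc (length-range (suc k) l)

range-∷ʳ : ∀ k l → range k (suc l) ≡ range k l ∷ʳ (k + l)
range-∷ʳ k zero    = cong [_] (sym (+-identityʳ k))
range-∷ʳ k (suc l) = cong (k ∷_) (trans (range-∷ʳ (suc k) l) (cong (range (suc k) l ∷ʳ_) (sym (+-suc k l))))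

applyUpTo-range : ∀ (f : ℕ → ℕ) k l → (∀ i → i < l → f i ≡ k + i) → applyUpTo f l ≡ range k l
applyUpTo-range f k zero    _  = refl
applyUpTo-range f k (suc l) f≡ =
  cong₂ _∷_ (trans (f≡ 0 z<s) (+-identityʳ k))
    (applyUpTo-range (λ i → f (suc i)) (suc k) l (λ i i<l → trans (f≡ (suc i) (s≤s i<l)) (+-suc k i)))

applyUpTo-++ : ∀ {A : Set} (f : ℕ → A) a b →
  applyUpTo f (a + b) ≡ applyUpTo f a ++ applyUpTo (λ i → f (a + i)) b
applyUpTo-++ f zero    b = refl
applyUpTo-++ f (suc a) b = cong (f 0 ∷_) (applyUpTo-++ (λ i → f (suc i)) a b)

positions-replicate : ∀ s x k l w →
  positions s k (replicate l x ++ w) ≡ (if occurs s x then range k l else []) ++ positions s (k + l) w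
positions-replicate s x k zero    w with occurs s x
... | true  = cong (λ j → positions s j w) (sym (+-identityʳ k))
... | false = cong (λ j → positions s j w) (sym (+-identityʳ k))
positions-replicate s x k (suc l) w with occurs s x in occ
... | true  = cong (k ∷_) (trans (positions-replicate s x (suc k) l w) shift)
  where shift = cong₂ _++_ (cong (λ o → if o then range (suc k) l else []) occ)
                           (cong (λ j → positions s j w) (sym (+-suc k l)))
... | false = trans (positions-replicate s x (suc k) l w) shift
  where shift = cong₂ _++_ (cong (λ o → if o then range (suc k) l else []) occ)
                           (cong (λ j → positions s j w) (sym (+-suc k l)))

positions-blocks : ∀ s x k y l z → positions s 1 ((replicate k x ++ replicate l y) ∷ʳ z) ≡
  (if occurs s x then range 1 k else []) ++ (if occurs s y then range (suc k) l else []) ++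
  (if occurs s z then [ suc (k + l) ] else [])
positions-blocks s x k y l z = begin
  positions s 1 ((replicate k x ++ replicate l y) ∷ʳ z) ≡⟨ cong (positions s 1) (++-assoc (replicate k x) _ [ z ]) ⟩
  positions s 1 (replicate k x ++ replicate l y ∷ʳ z)   ≡⟨ positions-replicate s x 1 k _ ⟩
  xs ++ positions s (suc k) (replicate l y ++ [ z ])    ≡⟨ cong (xs ++_) (positions-replicate s y (suc k) l [ z ]) ⟩
  xs ++ ys ++ positions s (suc (k + l)) [ z ]           ∎
  where
  open ≡-Reasoning
  xs = if occurs s x then range 1 k else []
  ys = if occurs s y then range (suc k) l else []

ξ-range : ∀ a b → ξ a b ≡ range (suc b) a ++ range 1 b
ξ-range a b =
  trans (applyUpTo-++ _ a b) (cong₂ _++_ (applyUpTo-range _ (suc b) a first) (applyUpTo-range _ 1 b second))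
  where
  first : ∀ i → i < a → (if ⌊ suc i ≤? a ⌋ then suc i + b else suc i ∸ a) ≡ suc b + i
  first i i<a with suc i ≤? a
  ... | yes _   = cong suc (+-comm i b)
  ... | no i≮a = ⊥-elim (i≮a i<a)
  second : ∀ i → i < b → (if ⌊ suc (a + i) ≤? a ⌋ then suc (a + i) + b else suc (a + i) ∸ a) ≡ 1 + i
  second i _ with suc (a + i) ≤? a
  ... | yes a+i<a = ⊥-elim (<⇒≱ a+i<a (m≤m+n a i))
  ... | no _      = trans (cong (_∸ a) (sym (+-suc a i))) (m+n∸m≡n a (suc i))

rk-++ : ∀ xs ys → rk (xs ++ ys) ≡ rk xs ⊔ rk ys
rk-++ []       ys = refl
rk-++ (x ∷ xs) ys = trans (cong (x ⊔_) (rk-++ xs ys)) (sym (⊔-assoc x (rk xs) (rk ys)))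

rk-range : ∀ k l → k ⊔ rk (range (suc k) l) ≡ k + l
rk-range k zero    = trans (⊔-identityʳ k) (sym (+-identityʳ k))
rk-range k (suc l) = begin
  k ⊔ (suc k ⊔ rk (range (suc (suc k)) l)) ≡⟨ ⊔-assoc k (suc k) _ ⟨
  (k ⊔ suc k) ⊔ rk (range (suc (suc k)) l) ≡⟨ cong (_⊔ rk (range (suc (suc k)) l)) (m≤n⇒m⊔n≡n (n≤1+n k)) ⟩
  suc k ⊔ rk (range (suc (suc k)) l)       ≡⟨ rk-range (suc k) l ⟩
  suc k + l                                ≡⟨ +-suc k l ⟨
  k + suc l                                ∎
  where open ≡-Reasoning

rk-ξ : ∀ a b → rk (ξ a b) ≡ a + b
rk-ξ a b = begin
  rk (ξ a b)                            ≡⟨ cong rk (ξ-range a b) ⟩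
  rk (range (suc b) a ++ range 1 b)     ≡⟨ rk-++ (range (suc b) a) (range 1 b) ⟩
  rk (range (suc b) a) ⊔ rk (range 1 b) ≡⟨ cong (rk (range (suc b) a) ⊔_) (rk-range 0 b) ⟩
  rk (range (suc b) a) ⊔ b              ≡⟨ ⊔-comm _ b ⟩
  b ⊔ rk (range (suc b) a)              ≡⟨ rk-range b a ⟩
  b + a                                 ≡⟨ +-comm b a ⟩
  a + b                                 ∎
  where open ≡-Reasoning

ξ×one₁-range : ∀ a b → ξ a b ×P one₁ ≡ range (suc b) a ++ range 1 b ∷ʳ suc (b + a)
ξ×one₁-range a b rewrite rk-ξ a b | ξ-range a b | +-comm a b | +-comm (b + a) 1 =
  ++-assoc (range (suc b) a) (range 1 b) [ suc (b + a) ]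

z₀-range : ∀ a b → z₀ (suc a) (suc b) ≡ range 1 a ++ suc (a + b) ∷ range (suc a) (suc b)
z₀-range a b rewrite applyUpTo-range suc 1 a (λ _ _ → refl)
                   | applyUpTo-range (suc a +_) (suc a) (suc b) (λ _ _ → refl) | +-suc a b = refl

z₁-range : ∀ a b → z₁ (suc a) b ≡ range 1 a ++ suc (a + b) ∷ range (suc a) b
z₁-range a b rewrite applyUpTo-range suc 1 a (λ _ _ → refl)
                   | applyUpTo-range (suc a +_) (suc a) b (λ _ _ → refl) = refl

top-R : ∀ a b → top R a b ≡ ξ a b ×P one₁
top-R a b rewrite positions-blocks left R b L a R | positions-blocks right R b L a R
                | ++-identityʳ (range (suc b) a) | ξ×one₁-range a b = refl

top-L : ∀ a b → top L a b ≡ ξ (suc a) b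
top-L a b rewrite positions-blocks left R b L a L | positions-blocks right R b L a L
                | ++-identityʳ (range 1 b) | ξ-range (suc a) b =
  cong (_++ range 1 b) (sym (range-∷ʳ (suc b) a))

bottom-LR : ∀ a b → bottom LR a b ≡ z₀ (suc a) (suc b)
bottom-LR a b rewrite positions-blocks left L a R b LR | positions-blocks right L a R b LR | z₀-range a b =
  trans (++-assoc (range 1 a) [ suc (a + b) ] _) (cong (λ u → range 1 a ++ suc (a + b) ∷ u) (sym (range-∷ʳ (suc a) b)))

bottom-L : ∀ a b → bottom L a b ≡ z₁ (suc a) b
bottom-L a b rewrite positions-blocks left L a R b L | positions-blocks right L a R b L
                   | ++-identityʳ (range (suc a) b) | z₁-range a b = ++-assoc (range 1 a) [ suc (a + b) ] _

map-at-shift : ∀ x xs k l → map (at (x ∷ xs)) (range (suc (suc k)) l) ≡ map (at xs) (range (suc k) l)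
map-at-shift x xs k zero    = refl
map-at-shift x xs k (suc l) = cong (at xs (suc k) ∷_) (map-at-shift x xs (suc k) l)

map-at-range : ∀ xs ys zs {k l} → length xs ≡ k → length ys ≡ l →
  map (at (xs ++ ys ++ zs)) (range (suc k) l) ≡ ys
map-at-range []       []       zs refl refl = refl
map-at-range []       (y ∷ ys) zs refl refl =
  cong (y ∷_) (trans (map-at-shift y (ys ++ zs) 0 (length ys)) (map-at-range [] ys zs refl refl))
map-at-range (x ∷ xs) ys       zs refl refl =
  trans (map-at-shift x (xs ++ ys ++ zs) (length xs) (length ys)) (map-at-range xs ys zs refl refl)

at-∷ʳ : ∀ xs x → at (xs ∷ʳ x) (suc (length xs)) ≡ x
at-∷ʳ []       x = refl
at-∷ʳ (y ∷ ys) x = at-∷ʳ ys x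

top-LR : ∀ a b → top LR a b ≡ (ξ a b ×P one₁) ∘P z₀ (suc a) (suc b)
top-LR a b = sym (begin
  (ξ a b ×P one₁) ∘P z₀ (suc a) (suc b)
    ≡⟨ cong₂ (λ X z → map (at X) z) (ξ×one₁-range a b) (z₀-range a b) ⟩
  map (at X) (range 1 a ++ suc (a + b) ∷ range (suc a) (suc b))
    ≡⟨ map-++ (at X) (range 1 a) _ ⟩
  map (at X) (range 1 a) ++ at X (suc (a + b)) ∷ map (at X) (range (suc a) (suc b))
    ≡⟨ cong₂ (λ u v → u ++ v ∷ map (at X) (range (suc a) (suc b)))
             (map-at-range [] P (Q ∷ʳ c) refl |P|) at-middle ⟩
  P ++ c ∷ map (at X) (range (suc a) (suc b))
    ≡⟨ cong (λ u → P ++ c ∷ u) last-block ⟩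
  P ++ c ∷ (Q ∷ʳ c)
    ≡⟨ ++-assoc P [ c ] (Q ∷ʳ c) ⟨
  (P ∷ʳ c) ++ (Q ∷ʳ c)
    ≡⟨ cong₂ _++_ (positions-blocks left R b L a LR) (positions-blocks right R b L a LR) ⟨
  top LR a b ∎)
  where
  open ≡-Reasoning
  P = range (suc b) a
  Q = range 1 b
  c = suc (b + a)
  X = P ++ Q ∷ʳ c
  |P| : length P ≡ a
  |P| = length-range (suc b) a
  at-middle : at X (suc (a + b)) ≡ c
  at-middle = begin
    at X (suc (a + b))           ≡⟨ cong (at X) (trans (sym (+-suc a b)) (cong (_+ suc b) (sym |P|))) ⟩
    at X (length P + suc b)      ≡⟨ at-++ʳ P (Q ∷ʳ c) z<s ⟩
    at (Q ∷ʳ c) (suc b)          ≡⟨ cong (λ k → at (Q ∷ʳ c) (suc k)) (sym (length-range 1 b)) ⟩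
    at (Q ∷ʳ c) (suc (length Q)) ≡⟨ at-∷ʳ Q c ⟩
    c                            ∎
  last-block : map (at X) (range (suc a) (suc b)) ≡ Q ∷ʳ c
  last-block = begin
    map (at X) (range (suc a) (suc b))
      ≡⟨ cong (λ Y → map (at (P ++ Y)) (range (suc a) (suc b))) (++-identityʳ (Q ∷ʳ c)) ⟨
    map (at (P ++ (Q ∷ʳ c) ++ [])) (range (suc a) (suc b))
      ≡⟨ map-at-range P (Q ∷ʳ c) [] |P| (trans (length-++ Q) (trans (+-comm _ 1) (cong suc (length-range 1 b)))) ⟩
    Q ∷ʳ c ∎

SH≻⇔ : ∀ a b γ → SH≻ (suc a) (suc b) γ ⇔
  (InP (suc a + suc b) γ × γ ≤B[ suc a + suc b ] (ξ (suc a) b ×P one₁))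
SH≻⇔ a b γ = mk⇔
  (λ (sh , end) → proj₁ sh , subst (γ ≤B[ N ]_) (top-R (suc a) b) (proj₂ (SH⇒between R (suc a) b z<s z<s sh end)))
  (λ (γ∈P , γ≤) → let γ≤top = subst (γ ≤B[ N ]_) (sym (top-R (suc a) b)) γ≤ in
     ≤B-top⇒SH R (suc a) b γ∈P γ≤top ,
     ascent (≤B⇒⊑ γ≤top) z<s (m<m+n (suc a) z<s) ≤-refl (top-EndOrder R (suc a) b z<s z<s))
  where N = suc a + suc b

SH•⇔ : ∀ a b γ → SH• (suc a) (suc b) γ ⇔
  (InP (suc a + suc b) γ × z₀ (suc a) (suc b) ≤B[ suc a + suc b ] γ ×
   γ ≤B[ suc a + suc b ] ((ξ a b ×P one₁) ∘P z₀ (suc a) (suc b)))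
SH•⇔ a b γ = mk⇔
  (λ (sh , end) → let (bottom≤γ , γ≤top) = SH⇒between LR a b z<s z<s sh end in
     proj₁ sh , subst (_≤B[ N ] γ) (bottom-LR a b) bottom≤γ , subst (γ ≤B[ N ]_) (top-LR a b) γ≤top)
  (λ (γ∈P , z₀≤γ , γ≤) → let bottom≤γ = subst (_≤B[ N ] γ) (sym (bottom-LR a b)) z₀≤γ
                             γ≤top    = subst (γ ≤B[ N ]_) (sym (top-LR a b)) γ≤ in
     ≤B-top⇒SH LR a b γ∈P γ≤top ,
     ≤-antisym
       (≮⇒≥ λ γ-descent →
          <-irrefl (sym (top-EndOrder LR a b z<s z<s)) (descent (≤B⇒⊑ γ≤top) z<s n<N ≤-refl γ-descent))
       (≮⇒≥ λ γ-ascent →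
          <-irrefl (bottom-EndOrder LR a b z<s z<s) (ascent (≤B⇒⊑ bottom≤γ) z<s n<N ≤-refl γ-ascent)))
  where
  N = suc a + suc b
  n<N : suc a < N
  n<N = m<m+n (suc a) z<s

SH≺⇔ : ∀ a b γ → SH≺ (suc a) (suc b) γ ⇔
  (InP (suc a + suc b) γ × z₁ (suc a) (suc b) ≤B[ suc a + suc b ] γ × γ ≤B[ suc a + suc b ] ξ (suc a) (suc b))
SH≺⇔ a b γ = mk⇔
  (λ (sh , end) → let (bottom≤γ , γ≤top) = SH⇒between L a (suc b) z<s z<s sh end in
     proj₁ sh , subst (_≤B[ N ] γ) (bottom-L a (suc b)) bottom≤γ , subst (γ ≤B[ N ]_) (top-L a (suc b)) γ≤top)
  (λ (γ∈P , z₁≤γ , γ≤) → let bottom≤γ = subst (_≤B[ N ] γ) (sym (bottom-L a (suc b))) z₁≤γ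
                             γ≤top    = subst (γ ≤B[ N ]_) (sym (top-L a (suc b))) γ≤ in
     ≤B-top⇒SH L a (suc b) γ∈P γ≤top ,
     descent (≤B⇒⊑ bottom≤γ) z<s (m<m+n (suc a) z<s) ≤-refl (bottom-EndOrder L a (suc b) z<s z<s))
  where N = suc a + suc b

mainTheorem10 : (n m : ℕ) → 1 ≤ n → 1 ≤ m →
    (∀ γ → SH≻ n m γ ⇔ (InP (n + m) γ × (γ ≤B[ n + m ] (ξ n (m ∸ 1) ×P one₁)))) ×
    (∀ γ → SH• n m γ ⇔ (InP (n + m) γ × (z₀ n m ≤B[ n + m ] γ) ×
                         (γ ≤B[ n + m ] ((ξ (n ∸ 1) (m ∸ 1) ×P one₁) ∘P z₀ n m)))) ×
    (∀ γ → SH≺ n m γ ⇔ (InP (n + m) γ × (z₁ n m ≤B[ n + m ] γ) × (γ ≤B[ n + m ] ξ n m)))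
mainTheorem10 (suc a) (suc b) _ _ = SH≻⇔ a b , SH•⇔ a b , SH≺⇔ a b
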